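{- Let $b \ge 2$ and $n \ge 1$ be integers, and let $\Lambda_n = \operatorname{lcm}(1, 2, \ldots, n)$. If $r \ge 1$ is an integer with $n \ge b^r - 1$, then $s_b(n!) \ge (b-1) r$ and $s_b(\Lambda_n) \ge (b-1) r$. In particular, for all $n \ge 1$, \[ s_b(n!) \ge (b-1)\lfloor \log_b(n+1) \rfloor \quad\text{and}\quad s_b(\Lambda_n) \ge (b-1)\lfloor \log_b(n+1) \rfloor, \] so there exists $C > 0$ depending only on $b$ with $s_b(n!) > C\log n$ and $s_b(\Lambda_n) > C \log n$ for all $n \ge 2$ with $n \ge b-1$.
   Context: For an integer $b \ge 2$ and a nonnegative integer $N$, $s_b(N)$ denotes the sum of the digits of the base-$b$ expansion of $N$. -}

module Defs where

open import Data.Nat using (ℕ; zero; suc; _+_; _*_; _≤_; NonZero)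
open import Data.Nat.DivMod using (_/_; _%_)
open import Data.Nat.LCM using (lcm)
open import Data.Bool using (if_then_else_)
open import Relation.Nullary.Decidable using (does)
open import Data.Nat using (_≤?_)

digitSumAux : ℕ → (b : ℕ) → .{{_ : NonZero b}} → ℕ → ℕ
digitSumAux zero    b n = 0
digitSumAux (suc f) b n = n % b + digitSumAux f b (n / b)

-- s_b(N): sum of base-b digits of N (fuel N suffices for b ≥ 2)
s : (b : ℕ) → .{{_ : NonZero b}} → ℕ → ℕ
s b N = digitSumAux N b N

Λ : ℕ → ℕ
Λ zero    = 1
Λ (suc n) = lcm (suc n) (Λ n)

floorLogAux : ℕ → (b : ℕ) → .{{_ : NonZero b}} → ℕ → ℕ
floorLogAux zero    b N = 0
floorLogAux (suc f) b N = if does (b ≤? N) then suc (floorLogAux f b (N / b)) else 0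

floorLog : (b : ℕ) → .{{_ : NonZero b}} → ℕ → ℕ
floorLog b N = floorLogAux N b N

-- Write N = B + A·b^r with B < b^r. The digits of N are those of B followed by those of A, so
-- s_b(N) = s_b(B) + s_b(A) ≥ s_b(B + A) by subadditivity of s_b, while B + A ≡ N (mod b^r − 1)
-- and B + A < N as soon as A ≥ 1. Descending in this way, every positive multiple of b^r − 1
-- has digit sum at least that of b^r − 1 itself, namely (b − 1)r. Both n! and Λ_n are multiples
-- of b^r − 1 whenever b^r − 1 ≤ n; taking r = ⌊log_b(n + 1)⌋ gives the logarithmic bound.
module Submission where

open import Defs
open import Data.Nat
  using (ℕ; zero; suc; _!; _+_; _*_; _∸_; _^_; _≤_; _<_; z≤n; s≤s; NonZero; pred; _≤ᵇ_; _<?_; >-nonZero)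
open import Data.Nat.Properties
open import Data.Nat.DivMod
open import Data.Nat.Divisibility
open import Data.Nat.LCM using (lcm; m∣lcm[m,n]; n∣lcm[m,n]; gcd*lcm)
open import Data.Nat.GCD using (gcd)
open import Data.Nat.Induction using (<-rec)
open import Data.Nat.Tactic.RingSolver using (solve-∀)
open import Data.Product using (_×_; Σ; _,_)
open import Data.Sum using (inj₁; inj₂)
open import Relation.Nullary using (yes; no)
open import Relation.Nullary.Reflects using (ofʸ; ofⁿ)
open import Relation.Nullary.Negation using (contradiction)
open import Relation.Binary.PropositionalEquality

DivisibleUpTo : ℕ → ℕ → Set
DivisibleUpTo n N = ∀ {m} → 1 ≤ m → m ≤ n → m ∣ N

n!-divisibleUpTo : ∀ n → DivisibleUpTo n (n !)
n!-divisibleUpTo n {suc j} _ 1+j≤n = ∣-trans (m∣m*n (j !)) (m≤n⇒m!∣n! 1+j≤n)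

Λ-divisibleUpTo : ∀ n → DivisibleUpTo n (Λ n)
Λ-divisibleUpTo zero    () z≤n
Λ-divisibleUpTo (suc n) 1≤m m≤1+n with m≤n⇒m<n∨m≡n m≤1+n
... | inj₁ m<1+n = ∣-trans (Λ-divisibleUpTo n 1≤m (≤-pred m<1+n)) (n∣lcm[m,n] (suc n) (Λ n))
... | inj₂ refl  = m∣lcm[m,n] (suc n) (Λ n)

lcm-positive : ∀ {m n} → 1 ≤ m → 1 ≤ n → 1 ≤ lcm m n
lcm-positive {m} {n} 1≤m 1≤n = n≢0⇒n>0 λ lcm≡0 → <⇒≢ (*-mono-≤ 1≤m 1≤n) (sym (begin
  m * n               ≡⟨ gcd*lcm m n ⟨
  gcd m n * lcm m n   ≡⟨ cong (gcd m n *_) lcm≡0 ⟩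
  gcd m n * 0         ≡⟨ *-zeroʳ (gcd m n) ⟩
  0                   ∎))
  where open ≡-Reasoning

Λ-positive : ∀ n → 1 ≤ Λ n
Λ-positive zero    = s≤s z≤n
Λ-positive (suc n) = lcm-positive (s≤s z≤n) (Λ-positive n)

1≤n⇒1+n≤2*n : ∀ {n} → 1 ≤ n → suc n ≤ 2 * n
1≤n⇒1+n≤2*n {n} 1≤n = ≤-trans (s≤s (≤-reflexive (sym (+-identityʳ n)))) (+-monoˡ-≤ (n + 0) 1≤n)

digits-regroup : ∀ d x e y c B → (d + x * B) + (e + y * B) + c ≡ (d + e + c) + (x + y) * B
digits-regroup = solve-∀

digit-sums-regroup : ∀ d e c X Y → (d + e + c) + (X + Y) ≡ (d + X) + (e + Y) + c
digit-sums-regroup = solve-∀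

shift-block : ∀ d q A B P → d + q * B + A * (B * P) ≡ d + (q + A * P) * B
shift-block = solve-∀

split-off-block : ∀ B A M → B + A * suc M ≡ A * M + (B + A)
split-off-block = solve-∀

carry-regroup : ∀ B w Q → B + w + Q * B ≡ w + (Q + 1) * B
carry-regroup = solve-∀

module DigitSum (b : ℕ) .{{_ : NonZero b}} (1<b : 1 < b) where

  0<b : 0 < b
  0<b = <⇒≤ 1<b

  0/b≡0 : 0 / b ≡ 0
  0/b≡0 = 0/n≡0 b

  0%b≡0 : 0 % b ≡ 0
  0%b≡0 = m<n⇒m%n≡m 0<b

  m≤1+n⇒m/b≤n : ∀ {m n} → m ≤ suc n → m / b ≤ n
  m≤1+n⇒m/b≤n {zero}  _   rewrite 0/b≡0 = z≤n
  m≤1+n⇒m/b≤n {suc m} 1+m≤1+n = ≤-pred (≤-trans (m/n<m (suc m) b 1<b) 1+m≤1+n)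

  digitSumAux-0 : ∀ f → digitSumAux f b 0 ≡ 0
  digitSumAux-0 zero    = refl
  digitSumAux-0 (suc f) rewrite 0%b≡0 | 0/b≡0 = digitSumAux-0 f

  digitSumAux-fuel : ∀ {f g n} → n ≤ f → n ≤ g → digitSumAux f b n ≡ digitSumAux g b n
  digitSumAux-fuel {f} {g} {zero} _ _ = trans (digitSumAux-0 f) (sym (digitSumAux-0 g))
  digitSumAux-fuel {suc f} {suc g} {suc n} (s≤s n≤f) (s≤s n≤g) =
    cong (suc n % b +_) (digitSumAux-fuel (m≤1+n⇒m/b≤n (s≤s n≤f)) (m≤1+n⇒m/b≤n (s≤s n≤g)))

  s-step : ∀ n → s b n ≡ n % b + s b (n / b)
  s-step zero    rewrite 0%b≡0 | 0/b≡0 = refl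
  s-step (suc n) = cong (suc n % b +_) (digitSumAux-fuel (m≤1+n⇒m/b≤n ≤-refl) ≤-refl)

  s-digit : ∀ {d} q → d < b → s b (d + q * b) ≡ d + s b q
  s-digit {d} q d<b = begin
    s b (d + q * b)                          ≡⟨ s-step (d + q * b) ⟩
    (d + q * b) % b + s b ((d + q * b) / b)  ≡⟨ cong₂ (λ r t → r + s b t) last-digit rest ⟩
    d + s b q                                ∎
    where
    open ≡-Reasoning
    last-digit : (d + q * b) % b ≡ d
    last-digit = trans ([m+kn]%n≡m%n d q b) (m<n⇒m%n≡m d<b)
    rest : (d + q * b) / b ≡ q
    rest = trans (+-distrib-/-∣ʳ d (divides-refl q)) (cong₂ _+_ (m<n⇒m/n≡0 d<b) (m*n/n≡m q b))

  -- t is two digits plus an incoming carry; when t ≥ b it sends a carry of 1 to Q.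
  s-carry-≤ : ∀ {t} Q {S} → t < b + b → (∀ {c} → c ≤ 1 → s b (Q + c) ≤ S + c) →
              s b (t + Q * b) ≤ t + S
  s-carry-≤ {t} Q {S} t<2b s[Q+c]≤ with t <? b
  ... | yes t<b = begin
    s b (t + Q * b)  ≡⟨ s-digit Q t<b ⟩
    t + s b Q        ≡⟨ cong (λ z → t + s b z) (+-identityʳ Q) ⟨
    t + s b (Q + 0)  ≤⟨ +-monoʳ-≤ t (s[Q+c]≤ z≤n) ⟩
    t + (S + 0)      ≡⟨ cong (t +_) (+-identityʳ S) ⟩
    t + S            ∎
    where open ≤-Reasoning
  ... | no t≮b with m≤n⇒∃[o]m+o≡n (≮⇒≥ t≮b)
  ... | w , refl = begin
    s b (b + w + Q * b)    ≡⟨ cong (s b) (carry-regroup b w Q) ⟩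
    s b (w + (Q + 1) * b)  ≡⟨ s-digit (Q + 1) (+-cancelˡ-< b w b t<2b) ⟩
    w + s b (Q + 1)        ≤⟨ +-monoʳ-≤ w (s[Q+c]≤ ≤-refl) ⟩
    w + (S + 1)            ≡⟨ cong (w +_) (+-comm S 1) ⟩
    w + suc S              ≡⟨ +-suc w S ⟩
    suc w + S              ≤⟨ +-monoˡ-≤ S (+-monoˡ-≤ w 0<b) ⟩
    b + w + S              ∎
    where open ≤-Reasoning

  s-+-carry-≤ : ∀ f {x y c} → x ≤ f → y ≤ f → c ≤ 1 → s b (x + y + c) ≤ s b x + s b y + c
  s-+-carry-≤ zero z≤n z≤n z≤n       = z≤n
  s-+-carry-≤ zero z≤n z≤n (s≤s z≤n) = +-monoˡ-≤ 0 (m%n≤m 1 b)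
  s-+-carry-≤ (suc f) {x} {y} {c} x≤1+f y≤1+f c≤1 = begin
    s b (x + y + c)                                     ≡⟨ cong (s b) split ⟩
    s b (t + (x / b + y / b) * b)                       ≤⟨ s-carry-≤ (x / b + y / b) t<2b s[x/b+y/b+c]≤ ⟩
    t + (s b (x / b) + s b (y / b))                     ≡⟨ digit-sums-regroup (x % b) (y % b) c _ _ ⟩
    (x % b + s b (x / b)) + (y % b + s b (y / b)) + c   ≡⟨ cong₂ (λ X Y → X + Y + c) (s-step x) (s-step y) ⟨
    s b x + s b y + c                                   ∎
    where
    open ≤-Reasoning
    t : ℕ
    t = x % b + y % b + c
    split : x + y + c ≡ t + (x / b + y / b) * b
    split = trans (cong₂ (λ X Y → X + Y + c) (m≡m%n+[m/n]*n x b) (m≡m%n+[m/n]*n y b))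
                  (digits-regroup (x % b) (x / b) (y % b) (y / b) c b)
    t<2b : t < b + b
    t<2b = begin-strict
      x % b + y % b + c      ≤⟨ +-monoʳ-≤ (x % b + y % b) c≤1 ⟩
      x % b + y % b + 1      ≡⟨ +-assoc (x % b) (y % b) 1 ⟩
      x % b + (y % b + 1)    ≡⟨ cong (x % b +_) (+-comm (y % b) 1) ⟩
      x % b + suc (y % b)    <⟨ +-mono-≤ (m%n<n x b) (m%n<n y b) ⟩
      b + b                  ∎
    s[x/b+y/b+c]≤ : ∀ {c} → c ≤ 1 → s b (x / b + y / b + c) ≤ s b (x / b) + s b (y / b) + c
    s[x/b+y/b+c]≤ = s-+-carry-≤ f (m≤1+n⇒m/b≤n x≤1+f) (m≤1+n⇒m/b≤n y≤1+f)

  s-+-≤ : ∀ x y → s b (x + y) ≤ s b x + s b y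
  s-+-≤ x y = begin
    s b (x + y)          ≡⟨ cong (s b) (+-identityʳ (x + y)) ⟨
    s b (x + y + 0)      ≤⟨ s-+-carry-≤ (x + y) (m≤m+n x y) (m≤n+m y x) z≤n ⟩
    s b x + s b y + 0    ≡⟨ +-identityʳ _ ⟩
    s b x + s b y        ∎
    where open ≤-Reasoning

  s-+-*-^ : ∀ r {B} A → B < b ^ r → s b (B + A * b ^ r) ≡ s b B + s b A
  s-+-*-^ zero    {zero}  A _ = cong (s b) (*-identityʳ A)
  s-+-*-^ zero    {suc _} A (s≤s ())
  s-+-*-^ (suc r) {B}     A B<b^1+r = begin
    s b (B + A * (b * b ^ r))                    ≡⟨ cong (λ z → s b (z + A * (b * b ^ r))) (m≡m%n+[m/n]*n B b) ⟩
    s b (B % b + B / b * b + A * (b * b ^ r))    ≡⟨ cong (s b) (shift-block (B % b) (B / b) A b (b ^ r)) ⟩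
    s b (B % b + (B / b + A * b ^ r) * b)        ≡⟨ s-digit (B / b + A * b ^ r) (m%n<n B b) ⟩
    B % b + s b (B / b + A * b ^ r)              ≡⟨ cong (B % b +_) (s-+-*-^ r A B/b<b^r) ⟩
    B % b + (s b (B / b) + s b A)                ≡⟨ +-assoc (B % b) _ _ ⟨
    B % b + s b (B / b) + s b A                  ≡⟨ cong (_+ s b A) (s-step B) ⟨
    s b B + s b A                                ∎
    where
    open ≡-Reasoning
    B/b<b^r : B / b < b ^ r
    B/b<b^r = m<n*o⇒m/o<n (subst (B <_) (*-comm b (b ^ r)) B<b^1+r)

  maxWithDigits : ℕ → ℕ
  maxWithDigits zero    = 0
  maxWithDigits (suc r) = b ∸ 1 + maxWithDigits r * b

  1≤b∸1 : 1 ≤ b ∸ 1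
  1≤b∸1 = ∸-monoˡ-≤ 1 1<b

  b∸1<b : b ∸ 1 < b
  b∸1<b = subst (b ∸ 1 <_) (suc-pred b) (n<1+n (b ∸ 1))

  suc-maxWithDigits : ∀ r → suc (maxWithDigits r) ≡ b ^ r
  suc-maxWithDigits zero    = refl
  suc-maxWithDigits (suc r) = begin
    suc (b ∸ 1) + maxWithDigits r * b   ≡⟨ cong (_+ maxWithDigits r * b) (suc-pred b) ⟩
    suc (maxWithDigits r) * b           ≡⟨ cong (_* b) (suc-maxWithDigits r) ⟩
    b ^ r * b                           ≡⟨ *-comm (b ^ r) b ⟩
    b * b ^ r                           ∎
    where open ≡-Reasoning

  s-maxWithDigits : ∀ r → s b (maxWithDigits r) ≡ (b ∸ 1) * r
  s-maxWithDigits zero    = sym (*-zeroʳ (b ∸ 1))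
  s-maxWithDigits (suc r) = begin
    s b (b ∸ 1 + maxWithDigits r * b)   ≡⟨ s-digit (maxWithDigits r) b∸1<b ⟩
    b ∸ 1 + s b (maxWithDigits r)       ≡⟨ cong (b ∸ 1 +_) (s-maxWithDigits r) ⟩
    b ∸ 1 + (b ∸ 1) * r                 ≡⟨ *-suc (b ∸ 1) r ⟨
    (b ∸ 1) * suc r                     ∎
    where open ≡-Reasoning

  1≤maxWithDigits : ∀ {r} → 1 ≤ r → 1 ≤ maxWithDigits r
  1≤maxWithDigits {suc r} _ = ≤-trans 1≤b∸1 (m≤m+n (b ∸ 1) (maxWithDigits r * b))

  s-multiple-of-maxWithDigits-≥ : ∀ {r} → 1 ≤ r → ∀ N → 1 ≤ N → maxWithDigits r ∣ N →
                                  (b ∸ 1) * r ≤ s b N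
  s-multiple-of-maxWithDigits-≥ {r} 1≤r = <-rec _ descend
    where
    M : ℕ
    M = maxWithDigits r
    instance
      b^r≢0 : NonZero (b ^ r)
      b^r≢0 = m^n≢0 b r
    descend : ∀ N → (∀ {N′} → N′ < N → 1 ≤ N′ → M ∣ N′ → (b ∸ 1) * r ≤ s b N′) →
              1 ≤ N → M ∣ N → (b ∸ 1) * r ≤ s b N
    descend N below 1≤N M∣N with N <? b ^ r
    ... | yes N<b^r = ≤-reflexive (trans (sym (s-maxWithDigits r)) (cong (s b) M≡N))
      where
      M≡N : M ≡ N
      M≡N = ≤-antisym (∣⇒≤ {{>-nonZero 1≤N}} M∣N)
                      (≤-pred (subst (N <_) (sym (suc-maxWithDigits r)) N<b^r))
    ... | no N≮b^r = begin
      (b ∸ 1) * r           ≤⟨ below N′<N (≤-trans 1≤A (m≤n+m A B)) M∣N′ ⟩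
      s b (B + A)           ≤⟨ s-+-≤ B A ⟩
      s b B + s b A         ≡⟨ s-+-*-^ r A (m%n<n N (b ^ r)) ⟨
      s b (B + A * b ^ r)   ≡⟨ cong (s b) (m≡m%n+[m/n]*n N (b ^ r)) ⟨
      s b N                 ∎
      where
      open ≤-Reasoning
      A B : ℕ
      A = N / b ^ r
      B = N % b ^ r
      1≤A : 1 ≤ A
      1≤A = m≥n⇒m/n>0 (≮⇒≥ N≮b^r)
      N≡A*M+[B+A] : N ≡ A * M + (B + A)
      N≡A*M+[B+A] = begin-equality
        N                   ≡⟨ m≡m%n+[m/n]*n N (b ^ r) ⟩
        B + A * b ^ r       ≡⟨ cong (λ z → B + A * z) (suc-maxWithDigits r) ⟨
        B + A * suc M       ≡⟨ split-off-block B A M ⟩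
        A * M + (B + A)     ∎
      N′<N : B + A < N
      N′<N = begin-strict
        B + A               <⟨ m<n+m (B + A) (*-mono-≤ 1≤A (1≤maxWithDigits 1≤r)) ⟩
        A * M + (B + A)     ≡⟨ N≡A*M+[B+A] ⟨
        N                   ∎
      M∣N′ : M ∣ B + A
      M∣N′ = ∣m+n∣m⇒∣n (subst (M ∣_) N≡A*M+[B+A] M∣N) (n∣m*n A)

  divisibleUpTo⇒[b∸1]*r≤s : ∀ r {n N} → 1 ≤ N → DivisibleUpTo n N → b ^ r ∸ 1 ≤ n →
                            (b ∸ 1) * r ≤ s b N
  divisibleUpTo⇒[b∸1]*r≤s zero    _   _     _        rewrite *-zeroʳ (b ∸ 1) = z≤n
  divisibleUpTo⇒[b∸1]*r≤s (suc r) {n} {N} 1≤N ∣N b^r∸1≤n =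
    s-multiple-of-maxWithDigits-≥ {suc r} (s≤s z≤n) N 1≤N (∣N (1≤maxWithDigits {suc r} (s≤s z≤n)) M≤n)
    where
    M≤n : maxWithDigits (suc r) ≤ n
    M≤n = subst (_≤ n) (cong pred (sym (suc-maxWithDigits (suc r)))) b^r∸1≤n

  b^floorLogAux≤ : ∀ f {N} → 1 ≤ N → b ^ floorLogAux f b N ≤ N
  b^floorLogAux≤ zero    1≤N = 1≤N
  b^floorLogAux≤ (suc f) {N} 1≤N with b ≤ᵇ N | ≤ᵇ-reflects-≤ b N
  ... | _ | ofⁿ _   = 1≤N
  ... | _ | ofʸ b≤N = begin
    b * b ^ floorLogAux f b (N / b)  ≤⟨ *-monoʳ-≤ b (b^floorLogAux≤ f (m≥n⇒m/n>0 b≤N)) ⟩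
    b * (N / b)                      ≡⟨ *-comm b (N / b) ⟩
    N / b * b                        ≤⟨ m/n*n≤m N b ⟩
    N                                ∎
    where open ≤-Reasoning

  <b^suc-floorLogAux : ∀ {f N} → N ≤ f → N < b ^ suc (floorLogAux f b N)
  <b^suc-floorLogAux {zero} z≤n = m^n>0 b 1
  <b^suc-floorLogAux {suc f} {N} N≤1+f with b ≤ᵇ N | ≤ᵇ-reflects-≤ b N
  ... | _ | ofⁿ b≰N = subst (N <_) (sym (*-identityʳ b)) (≰⇒> b≰N)
  ... | _ | ofʸ _   = begin-strict
    N                                       ≡⟨ m≡m%n+[m/n]*n N b ⟩
    N % b + N / b * b                       <⟨ +-monoˡ-< (N / b * b) (m%n<n N b) ⟩
    suc (N / b) * b                         ≤⟨ *-monoˡ-≤ b (<b^suc-floorLogAux (m≤1+n⇒m/b≤n N≤1+f)) ⟩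
    b ^ suc (floorLogAux f b (N / b)) * b   ≡⟨ *-comm _ b ⟩
    b ^ suc (suc (floorLogAux f b (N / b))) ∎
    where open ≤-Reasoning

  b^floorLog≤ : ∀ {N} → 1 ≤ N → b ^ floorLog b N ≤ N
  b^floorLog≤ {N} = b^floorLogAux≤ N

  <b^suc-floorLog : ∀ N → N < b ^ suc (floorLog b N)
  <b^suc-floorLog N = <b^suc-floorLogAux ≤-refl

  1≤floorLog : ∀ {N} → b ≤ N → 1 ≤ floorLog b N
  1≤floorLog {zero}  b≤0 = contradiction (≤-trans 0<b b≤0) λ ()
  1≤floorLog {suc N} b≤N with b ≤ᵇ suc N | ≤ᵇ-reflects-≤ b (suc N)
  ... | _ | ofʸ _   = s≤s z≤n
  ... | _ | ofⁿ b≰N = contradiction b≤N b≰N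

  divisibleUpTo⇒[b∸1]*floorLog≤s : ∀ {n N} → 1 ≤ N → DivisibleUpTo n N →
                                   (b ∸ 1) * floorLog b (n + 1) ≤ s b N
  divisibleUpTo⇒[b∸1]*floorLog≤s {n} 1≤N ∣N = divisibleUpTo⇒[b∸1]*r≤s _ 1≤N ∣N b^L∸1≤n
    where
    b^L∸1≤n : b ^ floorLog b (n + 1) ∸ 1 ≤ n
    b^L∸1≤n = subst (b ^ floorLog b (n + 1) ∸ 1 ≤_) (m+n∸n≡m n 1) (∸-monoˡ-≤ 1 (b^floorLog≤ (m≤n+m 1 n)))

  [b∸1]*floorLog≤⇒<b^[2*_] : ∀ {N S} → b ≤ N → (b ∸ 1) * floorLog b N ≤ S → N < b ^ (2 * S)
  [b∸1]*floorLog≤⇒<b^[2*_] {N} {S} b≤N [b∸1]*L≤S = begin-strict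
    N            <⟨ <b^suc-floorLog N ⟩
    b ^ suc L    ≤⟨ ^-monoʳ-≤ b (≤-trans (1≤n⇒1+n≤2*n (1≤floorLog b≤N)) (*-monoʳ-≤ 2 L≤S)) ⟩
    b ^ (2 * S)  ∎
    where
    open ≤-Reasoning
    L : ℕ
    L = floorLog b N
    L≤S : L ≤ S
    L≤S = ≤-trans (m≤n*m L (b ∸ 1) {{>-nonZero 1≤b∸1}}) [b∸1]*L≤S

mainTheorem7 : (b : ℕ) → .{{_ : NonZero b}} → 2 ≤ b →
    ((n r : ℕ) → 1 ≤ n → 1 ≤ r → b ^ r ∸ 1 ≤ n →
      ((b ∸ 1) * r ≤ s b (n !)) × ((b ∸ 1) * r ≤ s b (Λ n)))
    × ((n : ℕ) → 1 ≤ n →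
      ((b ∸ 1) * floorLog b (n + 1) ≤ s b (n !))
      × ((b ∸ 1) * floorLog b (n + 1) ≤ s b (Λ n)))
    × Σ ℕ (λ p → Σ ℕ (λ q → 1 ≤ p × 1 ≤ q ×
      ((n : ℕ) → 2 ≤ n → b ∸ 1 ≤ n →
        (n ^ p < b ^ (q * s b (n !))) × (n ^ p < b ^ (q * s b (Λ n))))))
mainTheorem7 b 1<b =
    (λ n r _ _ b^r∸1≤n →
        divisibleUpTo⇒[b∸1]*r≤s r (1≤n! n) (n!-divisibleUpTo n) b^r∸1≤n
      , divisibleUpTo⇒[b∸1]*r≤s r (Λ-positive n) (Λ-divisibleUpTo n) b^r∸1≤n)
  , (λ n _ → logBound-! n , logBound-Λ n)
  , 1 , 2 , s≤s z≤n , s≤s z≤n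
  , λ n _ b∸1≤n → n^1<b^[2*_] b∸1≤n (logBound-! n) , n^1<b^[2*_] b∸1≤n (logBound-Λ n)
  where
  open DigitSum b 1<b
  logBound-! : ∀ n → (b ∸ 1) * floorLog b (n + 1) ≤ s b (n !)
  logBound-! n = divisibleUpTo⇒[b∸1]*floorLog≤s (1≤n! n) (n!-divisibleUpTo n)
  logBound-Λ : ∀ n → (b ∸ 1) * floorLog b (n + 1) ≤ s b (Λ n)
  logBound-Λ n = divisibleUpTo⇒[b∸1]*floorLog≤s (Λ-positive n) (Λ-divisibleUpTo n)
  n^1<b^[2*_] : ∀ {n S} → b ∸ 1 ≤ n → (b ∸ 1) * floorLog b (n + 1) ≤ S → n ^ 1 < b ^ (2 * S)
  n^1<b^[2*_] {n} b∸1≤n bound = subst (_< _) (sym (*-identityʳ n))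
    (<-trans (m<m+n n (s≤s z≤n)) ([b∸1]*floorLog≤⇒<b^[2*_] b≤n+1 bound))
    where
    b≤n+1 : b ≤ n + 1
    b≤n+1 = subst₂ _≤_ (suc-pred b) (+-comm 1 n) (s≤s b∸1≤n)
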